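{- Let $D$ be a non-elliptic web all of whose boundary vertices have degree exactly $1$, with boundary vertices numbered $1,\dots,n$ clockwise, and with dominant sign and state string (KK-labeling with signs) $((s_1,j_1),\dots,(s_n,j_n))$. Let $i$ be the smallest index in $\{1,\dots,n-1\}$ with $j_{i+1}\neq 1$, and let $D'$ be the non-elliptic web obtained from $D$ by trimming at $i,i+1$. Then the state string obtained by reading, in clockwise order along the boundary of $D'$, the state of each edge of $D'$ adjacent to the boundary is the KK-labeling of $D'$.
   Context: A tensor diagram is a finite bipartite graph with a fixed proper coloring of its vertices by black and white, a fixed partition of its vertices into boundary vertices and internal vertices, such that every internal vertex has degree $3$ and carries a fixed cyclic order of its incident edges. A web is a tensor diagram embedded in an oriented disk, with the boundary vertices on the boundary circle, whose edges do not cross or touch except at endpoints (considered up to isotopy fixing the boundary). A web is non-elliptic if it has no multiple edges and no $4$-cycle all of whose vertices are internal. Sign and state strings: a sign and state string of length $n$ is a sequence $((s_1,j_1),\dots,(s_n,j_n))$ with $s_k\in\{+,-\}$ and $j_k\in\{ -1,0,1\}$. Assign weights in $\mathbb{R}^2$: $(+,1)\mapsto(1,0)$, $(+,0)\mapsto(-1/2,\sqrt3/2)$, $(+,-1)\mapsto(-1/2,-\sqrt3/2)$, and the weight of $(-,j)$ is the negative of the weight of $(+,-j)$. The path of the string is $\pi_0=0$, $\pi_k=\pi_{k-1}+(\text{weight of }(s_k,j_k))$. The string is dominant if $\pi_n=0$ and every $\pi_k$ lies in the dominant chamber $\{a(1,0)+b(1/2,\sqrt3/2): a,b\ge 0\}$.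 (In particular $j_1=1$ and $j_n=-1$ for a dominant string.) Growth algorithm (Khovanov–Kuperberg): place $n$ vertices on a horizontal segment in order $1,\dots,n$ from left to right, vertex $k$ black if $s_k=+$ and white if $s_k=-$, and draw a downward dangling edge from vertex $k$ labeled $(s_k,j_k)$. Repeatedly apply one of the following rules to two dangling edges adjacent in the current left-to-right order, labeled $(s,j)$ (left) and $(s',j')$ (right). If $s'=-s$: (i) if $(j,j')=(1,0)$, $(0,0)$, or $(0,-1)$, join each of the two edges to a new internal vertex, connect these two new vertices by a horizontal unlabeled edge, and from each new vertex draw one new downward dangling edge; the new left and right dangling edges are labeled $(-s,0),(s,1)$, resp. $(-s,-1),(s,1)$, resp. $(-s,-1),(s,0)$; (ii) if $(j,j')=(1,-1)$, join the two dangling edges into a single edge. If $s'=s$ and $(j,j')=(1,0)$, $(0,-1)$, or $(1,-1)$: join both edges to one new internal vertex and draw one new downward dangling edge labeled $(-s,1)$, resp. $(-s,-1)$, resp. $(-s,0)$. New dangling edges replace the consumed ones in the left-to-right order. Finally the ends of the segment are joined so the web lies in a disk and left-to-right becomes clockwise. Khovanov and Kuperberg showed: from a dominant string the algorithm terminates, the resulting web (and labeling) does not depend on the order in which rules are applied, and the result is a non-elliptic web with all boundary vertices of degree $1$; conversely each such web with boundary numbered $1,\dots,n$ clockwise arises from exactly one dominant string, with $s_k=+$ iff vertex $k$ is black. Its state string $(j_1,\dots,j_n)$ is the KK-labeling of the web. Trimming: with $i$ as in the claim, run the growth algorithm for $D$ by first applying a rule to the dangling edges from vertices $i$ and $i+1$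 (here $j_i=1$ and $j_{i+1}\in\{0,-1\}$). This is either (a) a rule of type (i) (opposite signs, $j_{i+1}=0$), (b) a same-sign rule, or (c) a rule of type (ii) (opposite signs, $j_{i+1}=-1$). The web $D'$ is obtained from $D$ as follows, keeping the rest of $D$ unchanged: in case (a), delete boundary vertices $i,i+1$, their edges, the two new internal vertices and the horizontal edge between them, and make the free ends of the two new downward edges into two new boundary vertices; in case (b), delete boundary vertices $i,i+1$, their edges and the new internal vertex, and make the free end of the new downward edge a new boundary vertex; in case (c), delete boundary vertices $i,i+1$ and the edge joining them. The boundary vertices of $D'$ are ordered $1,\dots,i-1$, then the new boundary vertices (left to right), then $i+2,\dots,n$; each new boundary edge carries the state assigned to it by the rule applied, and the other boundary edges keep their states from $D$. -}

module Defs where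

open import Data.Nat using (ℕ; zero; suc; _+_; _*_; _∸_; _≤_; _<_; _<ᵇ_; _≡ᵇ_)
open import Data.Nat.DivMod using (_/_; _%_; _mod_)
open import Data.Integer as ℤ using (ℤ; +_; -_)
open import Data.Bool using (Bool; true; false; if_then_else_)
open import Data.Fin as Fin using (Fin; toℕ; cast)
open import Data.List using (List; []; _∷_; _++_; length; map; take; drop; mapMaybe; lookup)
open import Data.Maybe using (Maybe; just; nothing; _>>=_)
open import Data.Product using (Σ; ∃; _×_; _,_; proj₁; proj₂)
open import Data.Sum using (_⊎_)
open import Data.Empty using (⊥)
open import Relation.Nullary using (¬_)
open import Relation.Binary.PropositionalEquality using (_≡_; _≢_)
open import Data.List.Membership.Propositional using (_∈_)
open import Function.Bundles using (_↔_; Inverse; _⇔_)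

data Sign : Set where
  plus minus : Sign          -- plus = black, minus = white

neg : Sign → Sign
neg plus  = minus
neg minus = plus

data St : Set where
  sm1 s0 sp1 : St

flipSt : St → St
flipSt sm1 = sp1
flipSt s0  = s0
flipSt sp1 = sm1

Label : Set
Label = Sign × St

-- Weights, written in coordinates w.r.t. the basis
--   e₁ = (1,0),  e₂ = (1/2, √3/2)   of ℝ²
-- (so (-1/2, √3/2) = e₂ - e₁ and (-1/2,-√3/2) = -e₂); the dominant
-- chamber is then exactly { a e₁ + b e₂ : a , b ≥ 0 }.

Vec2 : Set
Vec2 = ℤ × ℤ

_⊕_ : Vec2 → Vec2 → Vec2
(a , b) ⊕ (c , d) = (a ℤ.+ c , b ℤ.+ d)

⊖_ : Vec2 → Vec2
⊖ (a , b) = (- a , - b)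

weightPlus : St → Vec2
weightPlus sp1 = (+ 1 , + 0)
weightPlus s0  = (- (+ 1) , + 1)      -- (-1/2, √3/2)
weightPlus sm1 = (+ 0 , - (+ 1))      -- (-1/2,-√3/2)

weight : Label → Vec2
weight (plus  , j) = weightPlus j
weight (minus , j) = ⊖ weightPlus (flipSt j)

InChamber : Vec2 → Set
InChamber (a , b) = (+ 0 ℤ.≤ a) × (+ 0 ℤ.≤ b)

DominantFrom : Vec2 → List Label → Set
DominantFrom (a , b) []       = (a ≡ + 0) × (b ≡ + 0)
DominantFrom π       (x ∷ xs) = InChamber (π ⊕ weight x) × DominantFrom (π ⊕ weight x) xs

Dominant : List Label → Set
Dominant w = DominantFrom (+ 0 , + 0) w

-- Rules of the growth algorithm (on the labels of two adjacent
-- dangling edges, left then right)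

data RuleOut : Set where
  split : Label → Label → RuleOut   -- type (i): new left, new right label
  join  : RuleOut
  merge : Label → RuleOut

ruleOpp : Sign → St → St → Maybe RuleOut
ruleOpp s sp1 s0  = just (split (neg s , s0)  (s , sp1))
ruleOpp s s0  s0  = just (split (neg s , sm1) (s , sp1))
ruleOpp s s0  sm1 = just (split (neg s , sm1) (s , s0))
ruleOpp s sp1 sm1 = just join
ruleOpp s _   _   = nothing

ruleSame : Sign → St → St → Maybe RuleOut
ruleSame s sp1 s0  = just (merge (neg s , sp1))
ruleSame s s0  sm1 = just (merge (neg s , sm1))
ruleSame s sp1 sm1 = just (merge (neg s , s0))
ruleSame s _   _   = nothing

rule : Label → Label → Maybe RuleOut
rule (plus  , j) (minus , j') = ruleOpp plus j j'
rule (minus , j) (plus  , j') = ruleOpp minus j j'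
rule (plus  , j) (plus  , j') = ruleSame plus j j'
rule (minus , j) (minus , j') = ruleSame minus j j'

-- With nb boundary vertices and ni internal vertices, darts are natural
-- numbers:  boundary vertex k (0-indexed, clockwise) has the single dart
-- k (boundary vertices have degree 1);  internal vertex v has the darts
-- nb + 3v + c, c = 0,1,2, in its (clockwise) cyclic order.  An edge is a
-- pair of darts.  bcol / icol are the colours (plus = black).

record Web : Set where
  field
    nb   : ℕ
    bcol : List Sign
    ni   : ℕ
    icol : List Sign
    prs  : List (ℕ × ℕ)
open Web public

idart : ℕ → ℕ → Fin 3 → ℕ
idart n v c = n + 3 * v + toℕ c

data Dart (nb ni : ℕ) : Set where
  bd : Fin nb → Dart nb ni
  id : Fin ni → Fin 3 → Dart nb ni

enc : ∀ {nb ni} → Dart nb ni → ℕ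
enc     (bd k)  = toℕ k
enc {nb} (id v c) = idart nb (toℕ v) c

Adj : (W : Web) → Dart (nb W) (ni W) → Dart (nb W) (ni W) → Set
Adj W x y = ((enc x , enc y) ∈ prs W) ⊎ ((enc y , enc x) ∈ prs W)

lookupℕ : {A : Set} → List A → ℕ → Maybe A
lookupℕ []       _       = nothing
lookupℕ (x ∷ xs) zero    = just x
lookupℕ (x ∷ xs) (suc k) = lookupℕ xs k

add3 : Fin 3 → Fin 3 → Fin 3
add3 a b = (toℕ a + toℕ b) mod 3

-- isomorphism of combinatorial webs: identity on the (numbered) boundary,
-- a bijection of internal vertices preserving colours, and a rotation of
-- the cyclic order at each internal vertex, preserving the edges.
-- (= isotopy of webs in the disk fixing the boundary, for webs without
-- closed components)
dartMap : (W W' : Web) → nb W ≡ nb W' → (Fin (ni W) → Fin (ni W')) → (Fin (ni W) → Fin 3) →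
          Dart (nb W) (ni W) → Dart (nb W') (ni W')
dartMap W W' eb g r (bd k)   = bd (cast eb k)
dartMap W W' eb g r (id v c) = id (g v) (add3 c (r v))

record _≅_ (W W' : Web) : Set where
  field
    eb   : nb W ≡ nb W'
    ebc  : bcol W ≡ bcol W'
    f    : Fin (ni W) ↔ Fin (ni W')
    r    : Fin (ni W) → Fin 3
    ecol : ∀ v → lookupℕ (icol W) (toℕ v) ≡ lookupℕ (icol W') (toℕ (Inverse.to f v))
    eadj : ∀ x y → Adj W x y ⇔ Adj W' (dartMap W W' eb (Inverse.to f) r x) (dartMap W W' eb (Inverse.to f) r y)

data Vtx : Set where
  bv : ℕ → Vtx
  iv : ℕ → Vtx

vert : Web → ℕ → Vtx
vert W d = if d <ᵇ nb W then bv d else iv ((d ∸ nb W) / 3)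

SameEnds : Web → ℕ × ℕ → ℕ × ℕ → Set
SameEnds W (a , b) (a' , b') =
  ((vert W a ≡ vert W a') × (vert W b ≡ vert W b'))
  ⊎ ((vert W a ≡ vert W b') × (vert W b ≡ vert W a'))

EdgeBetween : Web → Vtx → Vtx → Set
EdgeBetween W u v = ∃ λ (e : ℕ × ℕ) → (e ∈ prs W) ×
  (((vert W (proj₁ e) ≡ u) × (vert W (proj₂ e) ≡ v))
   ⊎ ((vert W (proj₁ e) ≡ v) × (vert W (proj₂ e) ≡ u)))

NoMultipleEdges : Web → Set
NoMultipleEdges W = (k l : Fin (length (prs W))) → k ≢ l →
  ¬ SameEnds W (lookup (prs W) k) (lookup (prs W) l)

No4CycleInternal : Web → Set
No4CycleInternal W = (a b c d : ℕ) →
  a < ni W → b < ni W → c < ni W → d < ni W →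
  a ≢ b → a ≢ c → a ≢ d → b ≢ c → b ≢ d → c ≢ d →
  EdgeBetween W (iv a) (iv b) → EdgeBetween W (iv b) (iv c) →
  EdgeBetween W (iv c) (iv d) → EdgeBetween W (iv d) (iv a) → ⊥

NonElliptic : Web → Set
NonElliptic W = NoMultipleEdges W × No4CycleInternal W

-- A state records the internal vertices created so
-- far (count and colours), the edges created so far, and the dangling
-- edges in left-to-right order, each given by the dart at its upper end
-- and its label.  n = number of boundary vertices (fixes dart numbering).

record GState : Set where
  field
    gni   : ℕ
    gicol : List Sign
    gprs  : List (ℕ × ℕ)
    dang  : List (ℕ × Label)
open GState public

DL : Set
DL = ℕ × Label

act : ℕ → ℕ → List Sign → List (ℕ × ℕ) → DL → DL →
      Maybe (List DL × ℕ × List Sign × List (ℕ × ℕ))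
act n ni ic ps (a , (s , j)) (b , l') with rule (s , j) l'
... | nothing = nothing
... | just (split x y) =
  just ( (idart n ni (Fin.suc (Fin.suc Fin.zero)) , x)
         ∷ (idart n (suc ni) (Fin.suc Fin.zero) , y) ∷ []
       , suc (suc ni)
       , ic ++ (neg s ∷ s ∷ [])
       , ps ++ ( (a , idart n ni Fin.zero)
               ∷ (b , idart n (suc ni) Fin.zero)
               ∷ (idart n ni (Fin.suc Fin.zero) , idart n (suc ni) (Fin.suc (Fin.suc Fin.zero)))
               ∷ []) )
... | just join = just ([] , ni , ic , ps ++ ((a , b) ∷ []))
... | just (merge x) =
  just ( (idart n ni (Fin.suc (Fin.suc Fin.zero)) , x) ∷ []
       , suc ni
       , ic ++ (neg s ∷ [])
       , ps ++ ( (a , idart n ni Fin.zero)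
               ∷ (b , idart n ni (Fin.suc Fin.zero)) ∷ []) )

-- apply a rule at dangling positions p, p+1 (0-indexed)
stepAt : ℕ → ℕ → ℕ → List Sign → List (ℕ × ℕ) → List DL →
         Maybe (List DL × ℕ × List Sign × List (ℕ × ℕ))
stepAt n zero ni ic ps (x ∷ y ∷ rest) with act n ni ic ps x y
... | nothing = nothing
... | just (new , ni' , ic' , ps') = just (new ++ rest , ni' , ic' , ps')
stepAt n zero ni ic ps _ = nothing
stepAt n (suc p) ni ic ps [] = nothing
stepAt n (suc p) ni ic ps (x ∷ rest) with stepAt n p ni ic ps rest
... | nothing = nothing
... | just (d , ni' , ic' , ps') = just (x ∷ d , ni' , ic' , ps')

step : ℕ → ℕ → GState → Maybe GState
step n p st with stepAt n p (gni st) (gicol st) (gprs st) (dang st)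
... | nothing = nothing
... | just (d , ni' , ic' , ps') =
  just (record { gni = ni' ; gicol = ic' ; gprs = ps' ; dang = d })

run : ℕ → List ℕ → GState → Maybe GState
run n []       st = just st
run n (p ∷ ps) st = step n p st >>= run n ps

numberFrom : ℕ → List Label → List DL
numberFrom k []       = []
numberFrom k (x ∷ xs) = (k , x) ∷ numberFrom (suc k) xs

initState : List Label → GState
initState w = record { gni = 0 ; gicol = [] ; gprs = [] ; dang = numberFrom 0 w }

-- a complete run of the growth algorithm on w (sequence of positions at
-- which rules are applied) ending with no dangling edges
CompleteRun : List Label → List ℕ → GState → Set
CompleteRun w ps st = (run (length w) ps (initState w) ≡ just st) × (dang st ≡ [])

webOf : List Label → GState → Web
webOf w st = record
  { nb = length w ; bcol = map proj₁ w ; ni = gni st ; icol = gicol st ; prs = gprs st }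

Grows : List Label → Web → Set
Grows w W = ∃ λ ps → ∃ λ st → CompleteRun w ps st × (webOf w st ≅ W)

IsKKLabeling : Web → List St → Set
IsKKLabeling W js = ∃ λ (w : List Label) →
  (map proj₂ w ≡ js) × Dominant w × Grows w W

-- Labels by 1-indexed position

labAt : List Label → ℕ → Maybe Label
labAt w k = lookupℕ w (k ∸ 1)

stAt : List Label → ℕ → Maybe St
stAt w k with labAt w k
... | nothing = nothing
... | just (s , j) = just j

ruleAt : List Label → ℕ → Maybe RuleOut
ruleAt w i with labAt w i | labAt w (suc i)
... | just l | just l' = rule l l'
... | _      | _       = nothing

-- W is the web of a complete run on w whose first step is the
-- rule o at the dangling edges from vertices i, i+1 (1-indexed); hence the
-- new internal vertices of that rule are internal vertices 0 (and 1).

newLabels : RuleOut → List Label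
newLabels (split x y) = x ∷ y ∷ []
newLabels join        = []
newLabels (merge x)   = x ∷ []

nNew : RuleOut → ℕ
nNew (split _ _) = 2
nNew join        = 0
nNew (merge _)   = 1

-- position (0-based, among the new boundary vertices) of the free end of
-- the new downward edge at dart c of new internal vertex v
newDown : RuleOut → ℕ → ℕ → Maybe ℕ
newDown (split _ _) 0 2 = just 0
newDown (split _ _) 1 1 = just 1
newDown (merge _)   0 2 = just 0
newDown _           _ _ = nothing

-- renumbering of the darts of W into the darts of the trimmed web
-- (nothing = deleted dart); p = i - 1 is the 0-indexed left position
trimDart : ℕ → RuleOut → ℕ → ℕ → ℕ → Maybe ℕ
trimDart p o n ni' d =
  if d <ᵇ p then just d
  else if d <ᵇ suc (suc p) then nothing
  else if d <ᵇ n then just (d ∸ 2 + nNew o)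
  else (let v = (d ∸ n) / 3 ; c = (d ∸ n) % 3 ; nb' = n ∸ 2 + nNew o in
        if v <ᵇ nNew o
        then (newDown o v c >>= λ q → just (p + q))
        else just (nb' + 3 * (v ∸ nNew o) + c))

trimPair : ℕ → RuleOut → ℕ → ℕ → ℕ × ℕ → Maybe (ℕ × ℕ)
trimPair p o n ni' (a , b) =
  trimDart p o n ni' a >>= λ a' → trimDart p o n ni' b >>= λ b' → just (a' , b')

trim : ℕ → RuleOut → Web → Web
trim i o W = record
  { nb   = nb W ∸ 2 + nNew o
  ; bcol = take p (bcol W) ++ map proj₁ (newLabels o) ++ drop (suc (suc p)) (bcol W)
  ; ni   = ni W ∸ nNew o
  ; icol = drop (nNew o) (icol W)
  ; prs  = mapMaybe (trimPair p o (nb W) (ni W ∸ nNew o)) (prs W)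
  }
  where p = i ∸ 1

-- the sign and state string read off along the boundary of the trimmed web
readOff : List Label → ℕ → RuleOut → List Label
readOff w i o = take (i ∸ 1) w ++ newLabels o ++ drop (suc i) w

-- Write w = xs ++ x ∷ y ∷ ys with x, y the labels at i, i + 1, and let o be
-- the rule applied to them.  The string xs ++ newLabels o ++ ys read off
-- after trimming is dominant: the rule preserves the total weight of its
-- labels and, for a split, the new intermediate point of the path stays in
-- the chamber.  It also grows the trimmed web: trimming is a renumbering of
-- darts, and after its first step the run of the growth algorithm on w is
-- matched, step by step, by the same rule applications on the new string,
-- which create exactly the renumbered internal vertices and edges.
module Submission where

open import Defs
open import Data.Bool using (true; false; if_then_else_)
open import Data.Bool.Properties using (T-≡)
open import Data.Fin using (toℕ)
open import Data.Fin.Patterns using (0F; 1F; 2F)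
import Data.Fin.Properties as Finₚ
open import Data.Integer as ℤ using (0ℤ; +≤+)
import Data.Integer.Properties as ℤₚ
open import Data.List using (List; []; _∷_; _++_; length; map; mapMaybe; take; drop)
open import Data.List.Properties using (length-++; map-++; take-map; drop-map; ++-assoc; ++-identityʳ; mapMaybe-++)
open import Data.List.Relation.Binary.Pointwise using (Pointwise; []; _∷_; ++⁺)
open import Data.List.Relation.Unary.All using (All; []; _∷_)
open import Data.Maybe using (Maybe; just; nothing; _>>=_)
open import Data.Maybe.Relation.Binary.Pointwise as Maybe using (just; nothing)
open import Data.Nat using (ℕ; zero; suc; _+_; _*_; _∸_; _≤_; _<_; _<ᵇ_; _/_; _%_; NonZero; z≤n; s≤s; z<s; s<s)
open import Data.Nat.Properties
open import Data.Nat.DivMod using (+-distrib-/-∣ˡ; m*n/n≡m; m<n⇒m/n≡0; /-congˡ; [m+kn]%n≡m%n; m<n⇒m%n≡m)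
open import Data.Nat.Divisibility using (m∣m*n)
open import Data.Product using (∃-syntax; _×_; _,_; proj₁; proj₂)
open import Function.Bundles using (Equivalence; mk⇔)
open import Function.Construct.Identity using (↔-id)
open import Relation.Binary.PropositionalEquality

length-++-∷∷ : ∀ {A : Set} (xs : List A) x y ys → length (xs ++ x ∷ y ∷ ys) ≡ 2 + (length xs + length ys)
length-++-∷∷ []       x y ys = refl
length-++-∷∷ (z ∷ xs) x y ys = cong suc (length-++-∷∷ xs x y ys)

drop-++-length : ∀ {A : Set} (xs ys : List A) → drop (length xs) (xs ++ ys) ≡ ys
drop-++-length []       ys = refl
drop-++-length (x ∷ xs) ys = drop-++-length xs ys

mapMaybe-Pointwise : ∀ {A B : Set} {f : A → Maybe B} {xs ys} →
  Pointwise (λ x y → f x ≡ just y) xs ys → mapMaybe f xs ≡ ys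
mapMaybe-Pointwise []             = refl
mapMaybe-Pointwise (fx≡y ∷ rest) rewrite fx≡y = cong (_ ∷_) (mapMaybe-Pointwise rest)

mapMaybe-All-nothing : ∀ {A B : Set} {f : A → Maybe B} {xs} →
  All (λ x → f x ≡ nothing) xs → mapMaybe f xs ≡ []
mapMaybe-All-nothing []               = refl
mapMaybe-All-nothing (fx≡nothing ∷ rest) rewrite fx≡nothing = mapMaybe-All-nothing rest

numberFrom-++ : ∀ k xs ys → numberFrom k (xs ++ ys) ≡ numberFrom k xs ++ numberFrom (k + length xs) ys
numberFrom-++ k []       ys = cong (λ j → numberFrom j ys) (sym (+-identityʳ k))
numberFrom-++ k (x ∷ xs) ys =
  cong ((k , x) ∷_) (trans (numberFrom-++ (suc k) xs ys)
                           (cong (λ j → numberFrom (suc k) xs ++ numberFrom j ys) (sym (+-suc k (length xs)))))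

length-numberFrom : ∀ k xs → length (numberFrom k xs) ≡ length xs
length-numberFrom k []       = refl
length-numberFrom k (x ∷ xs) = cong suc (length-numberFrom (suc k) xs)

length-newLabels : ∀ o → length (newLabels o) ≡ nNew o
length-newLabels (split _ _) = refl
length-newLabels join        = refl
length-newLabels (merge _)   = refl

Pointwise-[]ˡ : ∀ {A B : Set} {R : A → B → Set} {ys} → Pointwise R [] ys → ys ≡ []
Pointwise-[]ˡ [] = refl

<ᵇ-true : ∀ {m n} → m < n → (m <ᵇ n) ≡ true
<ᵇ-true m<n = Equivalence.to T-≡ (<⇒<ᵇ m<n)

<ᵇ-false : ∀ {m n} → n ≤ m → (m <ᵇ n) ≡ false
<ᵇ-false z≤n       = refl
<ᵇ-false (s≤s n≤m) = <ᵇ-false n≤m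

[d*q+r]/d≡q : ∀ d q {r} .{{_ : NonZero d}} → r < d → (d * q + r) / d ≡ q
[d*q+r]/d≡q d q {r} r<d = begin
  (d * q + r) / d    ≡⟨ +-distrib-/-∣ˡ r (m∣m*n q) ⟩
  d * q / d + r / d  ≡⟨ cong₂ _+_ (trans (/-congˡ (*-comm d q)) (m*n/n≡m q d)) (m<n⇒m/n≡0 r<d) ⟩
  q + 0              ≡⟨ +-identityʳ q ⟩
  q                  ∎
  where open ≡-Reasoning

[d*q+r]%d≡r : ∀ d q {r} .{{_ : NonZero d}} → r < d → (d * q + r) % d ≡ r
[d*q+r]%d≡r d q {r} r<d = begin
  (d * q + r) % d  ≡⟨ cong (_% d) (trans (+-comm (d * q) r) (cong (λ k → r + k) (*-comm d q))) ⟩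
  (r + q * d) % d  ≡⟨ [m+kn]%n≡m%n r q d ⟩
  r % d            ≡⟨ m<n⇒m%n≡m r<d ⟩
  r                ∎
  where open ≡-Reasoning

-- Dominance

⊕-assoc : ∀ u v t → (u ⊕ v) ⊕ t ≡ u ⊕ (v ⊕ t)
⊕-assoc (a , b) (c , d) (e , f) = cong₂ _,_ (ℤₚ.+-assoc a c e) (ℤₚ.+-assoc b d f)

⊕-identityʳ : ∀ u → u ⊕ (0ℤ , 0ℤ) ≡ u
⊕-identityʳ (a , b) = cong₂ _,_ (ℤₚ.+-identityʳ a) (ℤₚ.+-identityʳ b)

0≤i⇒0≤i+n : ∀ {i} n → 0ℤ ℤ.≤ i → 0ℤ ℤ.≤ i ℤ.+ ℤ.+ n
0≤i⇒0≤i+n {i} n 0≤i = ℤₚ.≤-trans 0≤i (ℤₚ.i≤i+j i (ℤ.+ n))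

DominantFrom-∷∷⁻ : ∀ π x y ys → DominantFrom π (x ∷ y ∷ ys) →
  InChamber (π ⊕ (weight x ⊕ weight y)) × DominantFrom (π ⊕ (weight x ⊕ weight y)) ys
DominantFrom-∷∷⁻ π x y ys (_ , h) =
  subst (λ q → InChamber q × DominantFrom q ys) (⊕-assoc π (weight x) (weight y)) h

DominantFrom-∷∷⁺ : ∀ π x y ys → InChamber (π ⊕ weight x) →
  InChamber (π ⊕ (weight x ⊕ weight y)) × DominantFrom (π ⊕ (weight x ⊕ weight y)) ys →
  DominantFrom π (x ∷ y ∷ ys)
DominantFrom-∷∷⁺ π x y ys mid h =
  mid , subst (λ q → InChamber q × DominantFrom q ys) (sym (⊕-assoc π (weight x) (weight y))) h

split-DominantFrom : ∀ π x y l₁ l₂ ys → weight x ⊕ weight y ≡ weight l₁ ⊕ weight l₂ →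
  InChamber (π ⊕ weight l₁) → DominantFrom π (x ∷ y ∷ ys) → DominantFrom π (l₁ ∷ l₂ ∷ ys)
split-DominantFrom π x y l₁ l₂ ys eq mid h =
  DominantFrom-∷∷⁺ π l₁ l₂ ys mid
    (subst (λ t → InChamber (π ⊕ t) × DominantFrom (π ⊕ t) ys) eq (DominantFrom-∷∷⁻ π x y ys h))

join-DominantFrom : ∀ π x y ys → weight x ⊕ weight y ≡ (0ℤ , 0ℤ) →
  DominantFrom π (x ∷ y ∷ ys) → DominantFrom π ys
join-DominantFrom π x y ys eq h =
  subst (λ q → DominantFrom q ys) (trans (cong (π ⊕_) eq) (⊕-identityʳ π))
    (proj₂ (DominantFrom-∷∷⁻ π x y ys h))

merge-DominantFrom : ∀ π x y l ys → weight x ⊕ weight y ≡ weight l →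
  DominantFrom π (x ∷ y ∷ ys) → DominantFrom π (l ∷ ys)
merge-DominantFrom π x y l ys eq h =
  subst (λ t → InChamber (π ⊕ t) × DominantFrom (π ⊕ t) ys) eq (DominantFrom-∷∷⁻ π x y ys h)

end-InChamber : ∀ π x y ys → DominantFrom π (x ∷ y ∷ ys) → InChamber (π ⊕ (weight x ⊕ weight y))
end-InChamber π x y ys h = proj₁ (DominantFrom-∷∷⁻ π x y ys h)

-- For a split, each coordinate of the new intermediate point is either that
-- of π increased, or equal to that of a point on the old path.
rule-preserves-DominantFrom : ∀ π x y ys {o} → InChamber π → rule x y ≡ just o →
  DominantFrom π (x ∷ y ∷ ys) → DominantFrom π (newLabels o ++ ys)
rule-preserves-DominantFrom π x@(plus , sp1) y@(minus , s0) ys (0≤a , _) refl h =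
  split-DominantFrom π x y (minus , s0) (plus , sp1) ys refl
    (0≤i⇒0≤i+n 1 0≤a , proj₂ (end-InChamber π x y ys h)) h
rule-preserves-DominantFrom π x@(plus , s0) y@(minus , s0) ys (_ , 0≤b) refl h@((0≤a′ , _) , _) =
  split-DominantFrom π x y (minus , sm1) (plus , sp1) ys refl (0≤a′ , 0≤i⇒0≤i+n 0 0≤b) h
rule-preserves-DominantFrom π x@(plus , s0) y@(minus , sm1) ys (_ , 0≤b) refl h@((0≤a′ , _) , _) =
  split-DominantFrom π x y (minus , sm1) (plus , s0) ys refl (0≤a′ , 0≤i⇒0≤i+n 0 0≤b) h
rule-preserves-DominantFrom π x@(minus , sp1) y@(plus , s0) ys (_ , 0≤b) refl h =
  split-DominantFrom π x y (plus , s0) (minus , sp1) ys refl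
    (proj₁ (end-InChamber π x y ys h) , 0≤i⇒0≤i+n 1 0≤b) h
rule-preserves-DominantFrom π x@(minus , s0) y@(plus , s0) ys (0≤a , _) refl h@((_ , 0≤b′) , _) =
  split-DominantFrom π x y (plus , sm1) (minus , sp1) ys refl (0≤i⇒0≤i+n 0 0≤a , 0≤b′) h
rule-preserves-DominantFrom π x@(minus , s0) y@(plus , sm1) ys (0≤a , _) refl h@((_ , 0≤b′) , _) =
  split-DominantFrom π x y (plus , sm1) (minus , s0) ys refl (0≤i⇒0≤i+n 0 0≤a , 0≤b′) h
rule-preserves-DominantFrom π x@(plus , sp1) y@(minus , sm1) ys _ refl h =
  join-DominantFrom π x y ys refl h
rule-preserves-DominantFrom π x@(minus , sp1) y@(plus , sm1) ys _ refl h =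
  join-DominantFrom π x y ys refl h
rule-preserves-DominantFrom π x@(plus , sp1) y@(plus , s0) ys _ refl h =
  merge-DominantFrom π x y (minus , sp1) ys refl h
rule-preserves-DominantFrom π x@(plus , s0) y@(plus , sm1) ys _ refl h =
  merge-DominantFrom π x y (minus , sm1) ys refl h
rule-preserves-DominantFrom π x@(plus , sp1) y@(plus , sm1) ys _ refl h =
  merge-DominantFrom π x y (minus , s0) ys refl h
rule-preserves-DominantFrom π x@(minus , sp1) y@(minus , s0) ys _ refl h =
  merge-DominantFrom π x y (plus , sp1) ys refl h
rule-preserves-DominantFrom π x@(minus , s0) y@(minus , sm1) ys _ refl h =
  merge-DominantFrom π x y (plus , sm1) ys refl h
rule-preserves-DominantFrom π x@(minus , sp1) y@(minus , sm1) ys _ refl h =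
  merge-DominantFrom π x y (plus , s0) ys refl h

DominantFrom-replace : ∀ π xs x y ys {o} → InChamber π → rule x y ≡ just o →
  DominantFrom π (xs ++ x ∷ y ∷ ys) → DominantFrom π (xs ++ newLabels o ++ ys)
DominantFrom-replace π []       x y ys c r h        = rule-preserves-DominantFrom π x y ys c r h
DominantFrom-replace π (z ∷ zs) x y ys _ r (c , h) = c , DominantFrom-replace (π ⊕ weight z) zs x y ys c r h

Dominant-replace : ∀ xs x y ys {o} → rule x y ≡ just o →
  Dominant (xs ++ x ∷ y ∷ ys) → Dominant (xs ++ newLabels o ++ ys)
Dominant-replace xs x y ys = DominantFrom-replace (0ℤ , 0ℤ) xs x y ys (+≤+ z≤n , +≤+ z≤n)

-- Running the growth algorithm after trimming

Config : Set
Config = List DL × ℕ × List Sign × List (ℕ × ℕ)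

config : GState → Config
config st = dang st , gni st , gicol st , gprs st

step-from-stepAt : ∀ n q st {ds m cs es} →
  stepAt n q (gni st) (gicol st) (gprs st) (dang st) ≡ just (ds , m , cs , es) →
  step n q st ≡ just (record { gni = m ; gicol = cs ; gprs = es ; dang = ds })
step-from-stepAt n q st eq rewrite eq = refl

stepAt-++ : ∀ n m cs es (ds : List DL) a b rest {new c} → act n m cs es a b ≡ just (new , c) →
  stepAt n (length ds) m cs es (ds ++ a ∷ b ∷ rest) ≡ just (ds ++ new ++ rest , c)
stepAt-++ n m cs es []       a b rest eq rewrite eq = refl
stepAt-++ n m cs es (d ∷ ds) a b rest eq rewrite stepAt-++ n m cs es ds a b rest eq = refl

module Renaming (p n : ℕ) (o : RuleOut) (2+p≤n : 2 + p ≤ n) where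

  n′ : ℕ
  n′ = n ∸ 2 + nNew o

  -- trimDart does not inspect its fourth argument.
  rename : ℕ → Maybe ℕ
  rename = trimDart p o n 0

  renamePair : ℕ × ℕ → Maybe (ℕ × ℕ)
  renamePair = trimPair p o n 0

  rename-left : ∀ {d} → d < p → rename d ≡ just d
  rename-left d<p rewrite <ᵇ-true d<p = refl

  rename-deleted : ∀ {d} → p ≤ d → d < 2 + p → rename d ≡ nothing
  rename-deleted p≤d d<2+p rewrite <ᵇ-false p≤d | <ᵇ-true d<2+p = refl

  rename-right : ∀ {d} → 2 + p ≤ d → d < n → rename d ≡ just (d ∸ 2 + nNew o)
  rename-right 2+p≤d d<n
    rewrite <ᵇ-false (≤-trans (m≤n+m p 2) 2+p≤d) | <ᵇ-false 2+p≤d | <ᵇ-true d<n = refl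

  n≤idart : ∀ v c → n ≤ idart n v c
  n≤idart v c = ≤-trans (m≤m+n n (3 * v)) (m≤m+n (n + 3 * v) (toℕ c))

  idart∸n : ∀ v c → idart n v c ∸ n ≡ 3 * v + toℕ c
  idart∸n v c = trans (cong (_∸ n) (+-assoc n (3 * v) (toℕ c))) (m+n∸m≡n n (3 * v + toℕ c))

  rename-internal : ∀ v c → rename (idart n v c) ≡
    (if v <ᵇ nNew o then newDown o v (toℕ c) >>= (λ q → just (p + q))
                    else just (idart n′ (v ∸ nNew o) c))
  rename-internal v c
    rewrite <ᵇ-false (≤-trans (m≤n+m p 2) (≤-trans 2+p≤n (n≤idart v c)))
          | <ᵇ-false (≤-trans 2+p≤n (n≤idart v c))
          | <ᵇ-false {idart n v c} (n≤idart v c)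
          | idart∸n v c
          | [d*q+r]/d≡q 3 v (Finₚ.toℕ<n c)
          | [d*q+r]%d≡r 3 v (Finₚ.toℕ<n c) = refl

  rename-new : ∀ {v} c → v < nNew o → rename (idart n v c) ≡ (newDown o v (toℕ c) >>= λ q → just (p + q))
  rename-new {v} c v<k rewrite rename-internal v c | <ᵇ-true v<k = refl

  rename-old : ∀ v c → rename (idart n (v + nNew o) c) ≡ just (idart n′ v c)
  rename-old v c
    rewrite rename-internal (v + nNew o) c | <ᵇ-false (m≤n+m (nNew o) v) | m+n∸n≡m v (nNew o) = refl

  renamePair-just : ∀ {a a′ b b′} → rename a ≡ just a′ → rename b ≡ just b′ →
    renamePair (a , b) ≡ just (a′ , b′)
  renamePair-just ea eb rewrite ea | eb = refl

  renamePair-nothing : ∀ {a b} → rename a ≡ nothing → renamePair (a , b) ≡ nothing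
  renamePair-nothing ea rewrite ea = refl

  _⇝_ : DL → DL → Set
  (d , l) ⇝ (d′ , l′) = rename d ≡ just d′ × l ≡ l′

  numberFrom-left : ∀ k zs → k + length zs ≤ p → Pointwise _⇝_ (numberFrom k zs) (numberFrom k zs)
  numberFrom-left k []       _ = []
  numberFrom-left k (z ∷ zs) le =
    (rename-left (≤-trans (m<m+n k z<s) le) , refl)
    ∷ numberFrom-left (suc k) zs (subst (_≤ p) (+-suc k (length zs)) le)

  numberFrom-right : ∀ k zs → p ≤ k → 2 + k + length zs ≤ n →
    Pointwise _⇝_ (numberFrom (2 + k) zs) (numberFrom (k + nNew o) zs)
  numberFrom-right k []       _   _  = []
  numberFrom-right k (z ∷ zs) p≤k le =
    (rename-right (s≤s (s≤s p≤k)) (≤-trans (m<m+n (2 + k) z<s) le) , refl)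
    ∷ numberFrom-right (suc k) zs (≤-trans p≤k (n≤1+n k)) (subst (_≤ n) (+-suc (2 + k) (length zs)) le)

  -- pre: the colours of the internal vertices created by the first rule.
  module Simulation (pre : List Sign) where

    _≈_ : Config → Config → Set
    (ds , m , cs , es) ≈ (ds′ , m′ , cs′ , es′) =
      Pointwise _⇝_ ds ds′ × m ≡ m′ + nNew o × cs ≡ pre ++ cs′ × mapMaybe renamePair es ≡ es′

    _≋_ : GState → GState → Set
    st ≋ st′ = config st ≈ config st′

    act-sim : ∀ m cs es {es′ a a′ b b′} l l′ → rename a ≡ just a′ → rename b ≡ just b′ →
      mapMaybe renamePair es ≡ es′ →
      Maybe.Pointwise _≈_ (act n (m + nNew o) (pre ++ cs) es (a , l) (b , l′)) (act n′ m cs es′ (a′ , l) (b′ , l′))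
    act-sim m cs es (s , j) l′ ea eb es≡ with rule (s , j) l′
    ... | nothing = nothing
    ... | just (split _ _) =
      just ( (rename-old m 2F , refl) ∷ (rename-old (suc m) 1F , refl) ∷ []
           , refl
           , ++-assoc pre cs _
           , trans (mapMaybe-++ renamePair es _)
               (cong₂ _++_ es≡ (mapMaybe-Pointwise {f = renamePair}
                 (renamePair-just ea (rename-old m 0F) ∷ renamePair-just eb (rename-old (suc m) 0F)
                  ∷ renamePair-just (rename-old m 1F) (rename-old (suc m) 2F) ∷ []))) )
    ... | just join =
      just ([] , refl , refl , trans (mapMaybe-++ renamePair es _)
                                     (cong₂ _++_ es≡ (mapMaybe-Pointwise {f = renamePair} (renamePair-just ea eb ∷ []))))
    ... | just (merge _) =
      just ( (rename-old m 2F , refl) ∷ []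
           , refl
           , ++-assoc pre cs _
           , trans (mapMaybe-++ renamePair es _)
               (cong₂ _++_ es≡ (mapMaybe-Pointwise {f = renamePair}
                 (renamePair-just ea (rename-old m 0F) ∷ renamePair-just eb (rename-old m 1F) ∷ []))) )

    stepAt-sim : ∀ q m cs es {es′ ds ds′} → Pointwise _⇝_ ds ds′ → mapMaybe renamePair es ≡ es′ →
      Maybe.Pointwise _≈_ (stepAt n q (m + nNew o) (pre ++ cs) es ds) (stepAt n′ q m cs es′ ds′)
    stepAt-sim zero m cs es [] _ = nothing
    stepAt-sim zero m cs es (_ ∷ []) _ = nothing
    stepAt-sim zero m cs es {es′} {(a , l) ∷ (b , l′) ∷ ds} {(a′ , _) ∷ (b′ , _) ∷ ds′}
               ((ea , refl) ∷ (eb , refl) ∷ ds⇝) es≡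
      with act n (m + nNew o) (pre ++ cs) es (a , l) (b , l′) | act n′ m cs es′ (a′ , l) (b′ , l′)
         | act-sim m cs es l l′ ea eb es≡
    ... | nothing | nothing | nothing = nothing
    ... | just _  | just _  | just (new⇝ , rest) = just (++⁺ new⇝ ds⇝ , rest)
    stepAt-sim (suc q) m cs es [] _ = nothing
    stepAt-sim (suc q) m cs es {es′} {d ∷ ds} {d′ ∷ ds′} (d⇝ ∷ ds⇝) es≡
      with stepAt n q (m + nNew o) (pre ++ cs) es ds | stepAt n′ q m cs es′ ds′
         | stepAt-sim q m cs es ds⇝ es≡
    ... | nothing | nothing | nothing = nothing
    ... | just _  | just _  | just (ds⇝′ , rest) = just (d⇝ ∷ ds⇝′ , rest)

    step-sim : ∀ q {st st′} → st ≋ st′ → Maybe.Pointwise _≋_ (step n q st) (step n′ q st′)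
    step-sim q {record { gprs = es ; dang = ds }} {st′} (ds⇝ , refl , refl , es≡)
      with stepAt n q (gni st′ + nNew o) (pre ++ gicol st′) es ds
         | stepAt n′ q (gni st′) (gicol st′) (gprs st′) (dang st′)
         | stepAt-sim q (gni st′) (gicol st′) es ds⇝ es≡
    ... | nothing | nothing | nothing = nothing
    ... | just _  | just _  | just sim = just sim

    run-sim : ∀ qs {st st′ st₁} → st ≋ st′ → run n qs st ≡ just st₁ →
      ∃[ st₁′ ] run n′ qs st′ ≡ just st₁′ × st₁ ≋ st₁′
    run-sim []       {st′ = st′} sim refl = st′ , refl , sim
    run-sim (q ∷ qs) {st} {st′} sim eq with step n q st | step n′ q st′ | step-sim q {st} {st′} sim
    ... | nothing | nothing | nothing with () ← eq
    ... | just _  | just _  | just sim′ = run-sim qs sim′ eq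

first-act : ∀ p n o (2+p≤n : 2 + p ≤ n) x y → rule x y ≡ just o →
  let open Renaming p n o 2+p≤n in
  ∃[ ds ] ∃[ cs ] ∃[ es ] act n 0 [] [] (p , x) (suc p , y) ≡ just (ds , nNew o , cs , es)
    × Pointwise _⇝_ ds (numberFrom p (newLabels o))
    × All (λ e → renamePair e ≡ nothing) es
    × length cs ≡ nNew o
first-act p n o@(split _ _) 2+p≤n (s , j) y r with rule (s , j) y | r
... | _ | refl =
  _ , _ , _ , refl
  , (trans (rename-new 2F z<s) (cong just (+-identityʳ p)) , refl)
    ∷ (trans (rename-new 1F (s<s z<s)) (cong just (+-comm p 1)) , refl) ∷ []
  , renamePair-nothing (rename-deleted ≤-refl (n≤1+n (suc p)))
    ∷ renamePair-nothing (rename-deleted (n≤1+n p) ≤-refl)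
    ∷ renamePair-nothing (rename-new 1F z<s) ∷ []
  , refl
  where open Renaming p n o 2+p≤n
first-act p n o@join 2+p≤n (s , j) y r with rule (s , j) y | r
... | _ | refl =
  _ , _ , _ , refl , [] , renamePair-nothing (rename-deleted ≤-refl (n≤1+n (suc p))) ∷ [] , refl
  where open Renaming p n o 2+p≤n
first-act p n o@(merge _) 2+p≤n (s , j) y r with rule (s , j) y | r
... | _ | refl =
  _ , _ , _ , refl
  , (trans (rename-new 2F z<s) (cong just (+-identityʳ p)) , refl) ∷ []
  , renamePair-nothing (rename-deleted ≤-refl (n≤1+n (suc p)))
    ∷ renamePair-nothing (rename-deleted (n≤1+n p) ≤-refl) ∷ []
  , refl
  where open Renaming p n o 2+p≤n

-- Trimming

add3-identityʳ : ∀ c → add3 c 0F ≡ c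
add3-identityʳ 0F = refl
add3-identityʳ 1F = refl
add3-identityʳ 2F = refl

≅-refl : ∀ W → W ≅ W
≅-refl W = record
  { eb   = refl
  ; ebc  = refl
  ; f    = ↔-id _
  ; r    = λ _ → 0F
  ; ecol = λ _ → refl
  ; eadj = λ x y → mk⇔ (subst₂ (Adj W) (sym (dartMap-id x)) (sym (dartMap-id y)))
                       (subst₂ (Adj W) (dartMap-id x) (dartMap-id y))
  }
  where
  dartMap-id : ∀ x → dartMap W W refl (λ v → v) (λ _ → 0F) x ≡ x
  dartMap-id (bd k)   = cong bd (Finₚ.cast-is-id refl k)
  dartMap-id (id v c) = cong (id v) (add3-identityʳ c)

Web-≡ : ∀ {W W′ : Web} → nb W ≡ nb W′ → bcol W ≡ bcol W′ → ni W ≡ ni W′ →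
  icol W ≡ icol W′ → prs W ≡ prs W′ → W ≡ W′
Web-≡ refl refl refl refl refl = refl

split-at : ∀ p (w : List Label) → 2 + p ≤ length w →
  ∃[ xs ] ∃[ x ] ∃[ y ] ∃[ ys ] w ≡ xs ++ x ∷ y ∷ ys × length xs ≡ p
split-at zero    (x ∷ y ∷ ys) _         = [] , x , y , ys , refl , refl
split-at zero    (x ∷ [])     (s≤s ())
split-at (suc p) (z ∷ w)      (s≤s 2+p≤|w|) with split-at p w 2+p≤|w|
... | xs , x , y , ys , refl , refl = z ∷ xs , x , y , ys , refl , refl

ruleAt-++ : ∀ xs x y ys → ruleAt (xs ++ x ∷ y ∷ ys) (suc (length xs)) ≡ rule x y
ruleAt-++ []       x y ys = refl
ruleAt-++ (z ∷ xs) x y ys = ruleAt-++ xs x y ys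

readOff-++ : ∀ xs x y ys o → readOff (xs ++ x ∷ y ∷ ys) (suc (length xs)) o ≡ xs ++ newLabels o ++ ys
readOff-++ []       x y ys o = refl
readOff-++ (z ∷ xs) x y ys o = cong (z ∷_) (readOff-++ xs x y ys o)

map-readOff : ∀ {B : Set} (f : Label → B) w p o →
  map f (readOff w (suc p) o) ≡ take p (map f w) ++ map f (newLabels o) ++ drop (2 + p) (map f w)
map-readOff f w p o = begin
  map f (take p w ++ newLabels o ++ drop (2 + p) w)
    ≡⟨ map-++ f (take p w) _ ⟩
  map f (take p w) ++ map f (newLabels o ++ drop (2 + p) w)
    ≡⟨ cong (map f (take p w) ++_) (map-++ f (newLabels o) _) ⟩
  map f (take p w) ++ map f (newLabels o) ++ map f (drop (2 + p) w)
    ≡⟨ sym (cong₂ (λ as bs → as ++ map f (newLabels o) ++ bs) (take-map p w) (drop-map (2 + p) w)) ⟩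
  take p (map f w) ++ map f (newLabels o) ++ drop (2 + p) (map f w)
    ∎
  where open ≡-Reasoning

module Replacement (xs : List Label) (x y : Label) (ys : List Label) (o : RuleOut) where

  w w′ : List Label
  w  = xs ++ x ∷ y ∷ ys
  w′ = xs ++ newLabels o ++ ys

  p n : ℕ
  p = length xs
  n = length w

  length-w : n ≡ 2 + (p + length ys)
  length-w = length-++-∷∷ xs x y ys

  2+p≤n : 2 + p ≤ n
  2+p≤n = subst (2 + p ≤_) (sym length-w) (s≤s (s≤s (m≤m+n p (length ys))))

  open Renaming p n o 2+p≤n
  open Simulation using (run-sim)

  length-w′ : length w′ ≡ n′
  length-w′ = begin
    length (xs ++ newLabels o ++ ys)         ≡⟨ length-++ xs ⟩
    p + length (newLabels o ++ ys)           ≡⟨ cong (p +_) (length-++ (newLabels o)) ⟩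
    p + (length (newLabels o) + length ys)   ≡⟨ cong (λ k → p + (k + length ys)) (length-newLabels o) ⟩
    p + (nNew o + length ys)                 ≡⟨ cong (p +_) (+-comm (nNew o) (length ys)) ⟩
    p + (length ys + nNew o)                 ≡⟨ sym (+-assoc p (length ys) (nNew o)) ⟩
    p + length ys + nNew o                   ≡⟨ cong (λ m → m ∸ 2 + nNew o) (sym length-w) ⟩
    n ∸ 2 + nNew o                           ∎
    where open ≡-Reasoning

  numberFrom-w′ : numberFrom 0 w′ ≡ numberFrom 0 xs ++ numberFrom p (newLabels o) ++ numberFrom (p + nNew o) ys
  numberFrom-w′ = begin
    numberFrom 0 w′
      ≡⟨ numberFrom-++ 0 xs (newLabels o ++ ys) ⟩
    numberFrom 0 xs ++ numberFrom p (newLabels o ++ ys)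
      ≡⟨ cong (numberFrom 0 xs ++_) (numberFrom-++ p (newLabels o) ys) ⟩
    numberFrom 0 xs ++ numberFrom p (newLabels o) ++ numberFrom (p + length (newLabels o)) ys
      ≡⟨ cong (λ k → numberFrom 0 xs ++ numberFrom p (newLabels o) ++ numberFrom (p + k) ys) (length-newLabels o) ⟩
    numberFrom 0 xs ++ numberFrom p (newLabels o) ++ numberFrom (p + nNew o) ys
      ∎
    where open ≡-Reasoning

  first-step : rule x y ≡ just o →
    ∃[ st₁ ] step n p (initState w) ≡ just st₁ × length (gicol st₁) ≡ nNew o
           × Simulation._≋_ (gicol st₁) st₁ (initState w′)
  first-step x,y↦o with first-act p n o 2+p≤n x y x,y↦o
  ... | ds , cs , es , act≡ , ds⇝ , es-deleted , |cs| =
    _ , step-from-stepAt n p (initState w) stepAt≡ , |cs|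
      , subst (Pointwise _⇝_ dang₁) (sym numberFrom-w′)
          (++⁺ (numberFrom-left 0 xs ≤-refl) (++⁺ ds⇝ (numberFrom-right p ys ≤-refl (≤-reflexive (sym length-w)))))
      , refl , sym (++-identityʳ cs) , mapMaybe-All-nothing es-deleted
    where
    dang₁ : List DL
    dang₁ = numberFrom 0 xs ++ ds ++ numberFrom (2 + p) ys
    stepAt≡ : stepAt n p 0 [] [] (numberFrom 0 w) ≡ just (dang₁ , nNew o , cs , es)
    stepAt≡ = begin
      stepAt n p 0 [] [] (numberFrom 0 w)
        ≡⟨ cong (stepAt n p 0 [] []) (numberFrom-++ 0 xs (x ∷ y ∷ ys)) ⟩
      stepAt n p 0 [] [] (numberFrom 0 xs ++ (p , x) ∷ (suc p , y) ∷ numberFrom (2 + p) ys)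
        ≡⟨ cong (λ q → stepAt n q 0 [] [] (numberFrom 0 xs ++ (p , x) ∷ (suc p , y) ∷ numberFrom (2 + p) ys))
             (sym (length-numberFrom 0 xs)) ⟩
      stepAt n (length (numberFrom 0 xs)) 0 [] [] (numberFrom 0 xs ++ (p , x) ∷ (suc p , y) ∷ numberFrom (2 + p) ys)
        ≡⟨ stepAt-++ n 0 [] [] (numberFrom 0 xs) _ _ _ act≡ ⟩
      just (dang₁ , nNew o , cs , es)
        ∎
      where open ≡-Reasoning

  trim-grows : rule x y ≡ just o → ∀ ps st → CompleteRun w (p ∷ ps) st →
    Grows w′ (trim (suc p) o (webOf w st))
  trim-grows x,y↦o ps st (run≡ , dang≡[]) with first-step x,y↦o
  ... | st₁ , step≡ , |pre| , sim₁
    with run-sim (gicol st₁) ps sim₁ (subst (λ m → (m >>= run n ps) ≡ just st) step≡ run≡)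
  ... | st₂ , run′≡ , dang⇝ , gni≡ , gicol≡ , gprs≡ =
    ps , st₂
    , (subst (λ m → run m ps (initState w′) ≡ just st₂) (sym length-w′) run′≡
      , Pointwise-[]ˡ (subst (λ ds → Pointwise _⇝_ ds (dang st₂)) dang≡[] dang⇝))
    , subst (webOf w′ st₂ ≅_) (Web-≡ length-w′ bcol≡ ni≡ icol≡ (sym gprs≡)) (≅-refl (webOf w′ st₂))
    where
    bcol≡ : map proj₁ w′ ≡ take p (map proj₁ w) ++ map proj₁ (newLabels o) ++ drop (2 + p) (map proj₁ w)
    bcol≡ = trans (cong (map proj₁) (sym (readOff-++ xs x y ys o))) (map-readOff proj₁ w p o)
    ni≡ : gni st₂ ≡ gni st ∸ nNew o
    ni≡ = sym (trans (cong (_∸ nNew o) gni≡) (m+n∸n≡m (gni st₂) (nNew o)))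
    icol≡ : gicol st₂ ≡ drop (nNew o) (gicol st)
    icol≡ = sym (trans (cong (drop (nNew o)) gicol≡)
                       (subst (λ k → drop k (gicol st₁ ++ gicol st₂) ≡ gicol st₂) |pre| (drop-++-length (gicol st₁) (gicol st₂))))

lemma3p3 : (w : List Label) → Dominant w →
    (i : ℕ) → 1 ≤ i → suc i ≤ length w →
    stAt w (suc i) ≢ just sp1 →
    ((k : ℕ) → 1 ≤ k → k < i → stAt w (suc k) ≡ just sp1) →
    (ps : List ℕ) (st : GState) → CompleteRun w ((i ∸ 1) ∷ ps) st →
    NonElliptic (webOf w st) →
    (o : RuleOut) → ruleAt w i ≡ just o →
    IsKKLabeling (trim i o (webOf w st)) (map proj₂ (readOff w i o))
lemma3p3 w dom (suc p) (s≤s z≤n) 2+p≤|w| _ _ ps st run _ o w↦o with split-at p w 2+p≤|w|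
... | xs , x , y , ys , refl , refl =
  readOff w (suc p) o , refl ,
  subst (λ w′ → Dominant w′ × Grows w′ (trim (suc p) o (webOf w st))) (sym (readOff-++ xs x y ys o))
    (Dominant-replace xs x y ys x,y↦o dom , Replacement.trim-grows xs x y ys o x,y↦o ps st run)
  where
  x,y↦o : rule x y ≡ just o
  x,y↦o = trans (sym (ruleAt-++ xs x y ys)) w↦o
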